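{- There is no derivation in $\mathcal{IL}$ of a sequent $A\vdash I$ with $A$ an $I$-free $\alpha$-formula.
   Context: Formulae are built from an infinite set of propositional letters and a constant $I$ using binary connectives $\otimes$ and $\to$. An $\alpha$-formula is a formula considered up to strict associativity of $\otimes$ and strict unitality of $I$ ($A\otimes(B\otimes C)=(A\otimes B)\otimes C$, $A\otimes I=I\otimes A=A$, also inside subformulae); it is $I$-free if it contains no occurrence of $I$. System $\mathcal{IL}$: sequents $G\vdash A$ with $G,A$ $\alpha$-formulae. Axioms $A\vdash A$. Rules (letters denote $\alpha$-formulae, possibly $I$, with $\otimes$ the operation having unit $I$): interchange: from $G\otimes A\otimes B\otimes E\vdash D$ infer $G\otimes B\otimes A\otimes E\vdash D$; cut: from $C\vdash A$ and $G\otimes A\otimes E\vdash D$ infer $G\otimes C\otimes E\vdash D$; $(\to\vdash)$: from $C\vdash A$ and $B\otimes G\vdash D$ infer $C\otimes(A\to B)\otimes G\vdash D$; $(\vdash\to)$: from $A\otimes G\vdash C$ infer $G\vdash A\to C$; $(\otimes\vdash\otimes)$: from $A\vdash C$ and $B\vdash E$ infer $A\otimes B\vdash C\otimes E$. -}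

module Defs where

open import Data.Nat using (ℕ)
open import Data.List using (List; []; _∷_; [_]; _++_)
open import Data.List.Relation.Unary.All using (All)
open import Data.Product using (_×_)

-- α-formulae are represented by their unique normal form modulo strict
-- associativity of ⊗ and strict unitality of I: a (possibly empty) list of
-- "factors", each a propositional letter or an implication between α-formulae.

mutual
  data Factor : Set where
    var  : ℕ → Factor
    _⇒_  : AForm → AForm → Factor

  AForm : Set
  AForm = List Factor

I : AForm
I = []

infixr 6 _⊗_
_⊗_ : AForm → AForm → AForm
_⊗_ = _++_

mutual
  data IFreeFactor : Factor → Set where
    var-free : ∀ {n} → IFreeFactor (var n)
    ⇒-free   : ∀ {A B} → IFree A → IFree B → IFreeFactor (A ⇒ B)

  data IFree : AForm → Set where
    nonempty : ∀ {f fs} → IFreeFactor f → All IFreeFactor fs → IFree (f ∷ fs)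

infix 4 _⊢_
data _⊢_ : AForm → AForm → Set where
  ax    : ∀ {A} → A ⊢ A
  inter : ∀ {G A B E D} → G ⊗ A ⊗ B ⊗ E ⊢ D → G ⊗ B ⊗ A ⊗ E ⊢ D
  cut   : ∀ {C A G E D} → C ⊢ A → G ⊗ A ⊗ E ⊢ D → G ⊗ C ⊗ E ⊢ D
  →⊢    : ∀ {C A B G D} → C ⊢ A → B ⊗ G ⊢ D → C ⊗ [ A ⇒ B ] ⊗ G ⊢ D
  ⊢→    : ∀ {A G C} → A ⊗ G ⊢ C → G ⊢ [ A ⇒ C ]
  ⊗⊢⊗   : ∀ {A B C E} → A ⊢ C → B ⊢ E → A ⊗ B ⊢ C ⊗ E

{-# OPTIONS --safe #-}
-- Read ⊗ as the product, I as the unit and → as the residual of a commutative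
-- residuated preordered monoid: every rule of IL is sound, so A ⊢ D forces
-- ⟦ A ⟧ ≤ ⟦ D ⟧. In the three-element Sugihara monoid bot < unit < top, top is
-- idempotent and top ⊸ top = top, so valuing every letter as top values every
-- I-free formula as top, whereas ⟦ I ⟧ = unit and top ≰ unit.
module Submission where

open import Defs
open import Data.List using ([]; _∷_; [_])
open import Data.List.Relation.Unary.All using (All; []; _∷_)
open import Data.Nat using (ℕ)
open import Function.Base using (const)
open import Relation.Binary.Bundles using (Preorder)
open import Relation.Binary.PropositionalEquality
  using (_≡_; refl; sym; trans; cong; cong₂; subst₂; isEquivalence; module ≡-Reasoning)
open import Relation.Binary.Structures using (IsPreorder)
open import Relation.Nullary using (¬_)

record ResiduatedCommutativePromonoid : Set₁ where
  infixl 7 _∙_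
  infixr 6 _⊸_
  infix  4 _≤_
  field
    Carrier     : Set
    _≤_         : Carrier → Carrier → Set
    _∙_         : Carrier → Carrier → Carrier
    ε           : Carrier
    _⊸_         : Carrier → Carrier → Carrier
    isPreorder  : IsPreorder _≡_ _≤_
    ∙-assoc     : ∀ a b c → a ∙ b ∙ c ≡ a ∙ (b ∙ c)
    ∙-comm      : ∀ a b → a ∙ b ≡ b ∙ a
    ∙-identityˡ : ∀ a → ε ∙ a ≡ a
    ∙-monoˡ-≤   : ∀ {a b} c → a ≤ b → a ∙ c ≤ b ∙ c
    ⊸-intro     : ∀ {a b c} → a ∙ b ≤ c → b ≤ a ⊸ c
    ⊸-elim      : ∀ {a b c} → b ≤ a ⊸ c → a ∙ b ≤ c

  open IsPreorder isPreorder public using ()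
    renaming (refl to ≤-refl; trans to ≤-trans; ≲-respˡ-≈ to ≤-respˡ-≡; ≲-respʳ-≈ to ≤-respʳ-≡)

  preorder : Preorder _ _ _
  preorder = record { isPreorder = isPreorder }

  ∙-identityʳ : ∀ a → a ∙ ε ≡ a
  ∙-identityʳ a = trans (∙-comm a ε) (∙-identityˡ a)

  ∙-monoʳ-≤ : ∀ c {a b} → a ≤ b → c ∙ a ≤ c ∙ b
  ∙-monoʳ-≤ c {a} {b} a≤b =
    subst₂ _≤_ (∙-comm a c) (∙-comm b c) (∙-monoˡ-≤ c a≤b)

  ∙-mono-≤ : ∀ {a b c d} → a ≤ b → c ≤ d → a ∙ c ≤ b ∙ d
  ∙-mono-≤ {b = b} {c = c} a≤b c≤d = ≤-trans (∙-monoˡ-≤ c a≤b) (∙-monoʳ-≤ b c≤d)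

  modus-ponens : ∀ a b → a ∙ (a ⊸ b) ≤ b
  modus-ponens a b = ⊸-elim ≤-refl

  ∙-exchange : ∀ a b c → a ∙ (b ∙ c) ≡ b ∙ (a ∙ c)
  ∙-exchange a b c = begin
    a ∙ (b ∙ c) ≡⟨ sym (∙-assoc a b c) ⟩
    a ∙ b ∙ c   ≡⟨ cong (_∙ c) (∙-comm a b) ⟩
    b ∙ a ∙ c   ≡⟨ ∙-assoc b a c ⟩
    b ∙ (a ∙ c) ∎
    where open ≡-Reasoning

module _ (M : ResiduatedCommutativePromonoid) where
  open ResiduatedCommutativePromonoid M

  module Interpretation (v : ℕ → Carrier) where
    mutual
      ⟦_⟧ᶠ : Factor → Carrier
      ⟦ var x ⟧ᶠ = v x
      ⟦ A ⇒ B ⟧ᶠ = ⟦ A ⟧ ⊸ ⟦ B ⟧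

      ⟦_⟧ : AForm → Carrier
      ⟦ [] ⟧    = ε
      ⟦ f ∷ A ⟧ = ⟦ f ⟧ᶠ ∙ ⟦ A ⟧

    ⟦⊗⟧ : ∀ A B → ⟦ A ⊗ B ⟧ ≡ ⟦ A ⟧ ∙ ⟦ B ⟧
    ⟦⊗⟧ []      B = sym (∙-identityˡ ⟦ B ⟧)
    ⟦⊗⟧ (f ∷ A) B = trans (cong (⟦ f ⟧ᶠ ∙_) (⟦⊗⟧ A B)) (sym (∙-assoc ⟦ f ⟧ᶠ ⟦ A ⟧ ⟦ B ⟧))

    ⟦⊗⟧-congʳ : ∀ G {A B} → ⟦ A ⟧ ≡ ⟦ B ⟧ → ⟦ G ⊗ A ⟧ ≡ ⟦ G ⊗ B ⟧
    ⟦⊗⟧-congʳ []      eq = eq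
    ⟦⊗⟧-congʳ (f ∷ G) eq = cong (⟦ f ⟧ᶠ ∙_) (⟦⊗⟧-congʳ G eq)

    ⟦⊗⟧-monoˡ-≤ : ∀ E {A B} → ⟦ A ⟧ ≤ ⟦ B ⟧ → ⟦ A ⊗ E ⟧ ≤ ⟦ B ⊗ E ⟧
    ⟦⊗⟧-monoˡ-≤ E {A} {B} le =
      subst₂ _≤_ (sym (⟦⊗⟧ A E)) (sym (⟦⊗⟧ B E)) (∙-monoˡ-≤ ⟦ E ⟧ le)

    ⟦⊗⟧-monoʳ-≤ : ∀ G {A B} → ⟦ A ⟧ ≤ ⟦ B ⟧ → ⟦ G ⊗ A ⟧ ≤ ⟦ G ⊗ B ⟧
    ⟦⊗⟧-monoʳ-≤ []      le = le
    ⟦⊗⟧-monoʳ-≤ (f ∷ G) le = ∙-monoʳ-≤ ⟦ f ⟧ᶠ (⟦⊗⟧-monoʳ-≤ G le)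

    ⟦⊗⟧-exchange : ∀ A B E → ⟦ A ⊗ B ⊗ E ⟧ ≡ ⟦ B ⊗ A ⊗ E ⟧
    ⟦⊗⟧-exchange A B E = begin
      ⟦ A ⊗ B ⊗ E ⟧           ≡⟨ trans (⟦⊗⟧ A _) (cong (⟦ A ⟧ ∙_) (⟦⊗⟧ B E)) ⟩
      ⟦ A ⟧ ∙ (⟦ B ⟧ ∙ ⟦ E ⟧) ≡⟨ ∙-exchange ⟦ A ⟧ ⟦ B ⟧ ⟦ E ⟧ ⟩
      ⟦ B ⟧ ∙ (⟦ A ⟧ ∙ ⟦ E ⟧) ≡⟨ sym (trans (⟦⊗⟧ B _) (cong (⟦ B ⟧ ∙_) (⟦⊗⟧ A E))) ⟩
      ⟦ B ⊗ A ⊗ E ⟧           ∎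
      where open ≡-Reasoning

    sound : ∀ {G D} → G ⊢ D → ⟦ G ⟧ ≤ ⟦ D ⟧
    sound ax = ≤-refl
    sound (inter {G} {A} {B} {E} d) =
      ≤-respˡ-≡ (⟦⊗⟧-congʳ G (⟦⊗⟧-exchange A B E)) (sound d)
    sound (cut {C} {A} {G} {E} d₁ d₂) =
      ≤-trans (⟦⊗⟧-monoʳ-≤ G (⟦⊗⟧-monoˡ-≤ E {C} {A} (sound d₁))) (sound d₂)
    sound (→⊢ {C} {A} {B} {G} {D} d₁ d₂) = begin
      ⟦ C ⊗ [ A ⇒ B ] ⊗ G ⟧               ≡⟨ ⟦⊗⟧ C _ ⟩
      ⟦ C ⟧ ∙ ((⟦ A ⟧ ⊸ ⟦ B ⟧) ∙ ⟦ G ⟧)   ≡⟨ sym (∙-assoc ⟦ C ⟧ _ ⟦ G ⟧) ⟩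
      ⟦ C ⟧ ∙ (⟦ A ⟧ ⊸ ⟦ B ⟧) ∙ ⟦ G ⟧     ≲⟨ ∙-monoˡ-≤ ⟦ G ⟧ (∙-monoˡ-≤ _ (sound d₁)) ⟩
      ⟦ A ⟧ ∙ (⟦ A ⟧ ⊸ ⟦ B ⟧) ∙ ⟦ G ⟧     ≲⟨ ∙-monoˡ-≤ ⟦ G ⟧ (modus-ponens ⟦ A ⟧ ⟦ B ⟧) ⟩
      ⟦ B ⟧ ∙ ⟦ G ⟧                       ≡⟨ sym (⟦⊗⟧ B G) ⟩
      ⟦ B ⊗ G ⟧                           ≲⟨ sound d₂ ⟩
      ⟦ D ⟧                               ∎
      where open import Relation.Binary.Reasoning.Preorder preorder
    sound (⊢→ {A} {G} {C} d) =
      ≤-respʳ-≡ (sym (∙-identityʳ _)) (⊸-intro (≤-respˡ-≡ (⟦⊗⟧ A G) (sound d)))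
    sound (⊗⊢⊗ {A} {B} {C} {E} d₁ d₂) =
      subst₂ _≤_ (sym (⟦⊗⟧ A B)) (sym (⟦⊗⟧ C E)) (∙-mono-≤ (sound d₁) (sound d₂))

  module _ {t : Carrier} (t∙t≡t : t ∙ t ≡ t) (t⊸t≡t : t ⊸ t ≡ t) where
    open Interpretation (const t)

    mutual
      IFreeFactor⇒⟦⟧ᶠ≡t : ∀ {f} → IFreeFactor f → ⟦ f ⟧ᶠ ≡ t
      IFreeFactor⇒⟦⟧ᶠ≡t var-free     = refl
      IFreeFactor⇒⟦⟧ᶠ≡t (⇒-free A B) =
        trans (cong₂ _⊸_ (IFree⇒⟦⟧≡t A) (IFree⇒⟦⟧≡t B)) t⊸t≡t

      All-IFreeFactor⇒t∙⟦⟧≡t : ∀ {A} → All IFreeFactor A → t ∙ ⟦ A ⟧ ≡ t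
      All-IFreeFactor⇒t∙⟦⟧≡t []               = ∙-identityʳ t
      All-IFreeFactor⇒t∙⟦⟧≡t {f ∷ A} (fᶠ ∷ Aᶠ) = begin
        t ∙ (⟦ f ⟧ᶠ ∙ ⟦ A ⟧) ≡⟨ cong (λ x → t ∙ (x ∙ ⟦ A ⟧)) (IFreeFactor⇒⟦⟧ᶠ≡t fᶠ) ⟩
        t ∙ (t ∙ ⟦ A ⟧)      ≡⟨ sym (∙-assoc t t ⟦ A ⟧) ⟩
        t ∙ t ∙ ⟦ A ⟧        ≡⟨ cong (_∙ ⟦ A ⟧) t∙t≡t ⟩
        t ∙ ⟦ A ⟧            ≡⟨ All-IFreeFactor⇒t∙⟦⟧≡t Aᶠ ⟩
        t                    ∎
        where open ≡-Reasoning

      IFree⇒⟦⟧≡t : ∀ {A} → IFree A → ⟦ A ⟧ ≡ t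
      IFree⇒⟦⟧≡t (nonempty {f} {A} fᶠ Aᶠ) =
        trans (cong (_∙ ⟦ A ⟧) (IFreeFactor⇒⟦⟧ᶠ≡t fᶠ)) (All-IFreeFactor⇒t∙⟦⟧≡t Aᶠ)

    IFree⇒¬⊢I : ¬ (t ≤ ε) → ∀ {A} → IFree A → ¬ (A ⊢ I)
    IFree⇒¬⊢I t≰ε Aᶠ d = t≰ε (≤-respˡ-≡ (IFree⇒⟦⟧≡t Aᶠ) (sound d))

data S₃ : Set where
  bot unit top : S₃

infix 4 _≤₃_
data _≤₃_ : S₃ → S₃ → Set where
  bot≤      : ∀ {a} → bot ≤₃ a
  ≤top      : ∀ {a} → a ≤₃ top
  unit≤unit : unit ≤₃ unit

≤₃-refl : ∀ {a} → a ≤₃ a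
≤₃-refl {bot}  = bot≤
≤₃-refl {unit} = unit≤unit
≤₃-refl {top}  = ≤top

≤₃-trans : ∀ {a b c} → a ≤₃ b → b ≤₃ c → a ≤₃ c
≤₃-trans bot≤      _         = bot≤
≤₃-trans _         ≤top      = ≤top
≤₃-trans unit≤unit unit≤unit = unit≤unit

≤₃-isPreorder : IsPreorder _≡_ _≤₃_
≤₃-isPreorder = record
  { isEquivalence = isEquivalence
  ; reflexive     = λ { refl → ≤₃-refl }
  ; trans         = ≤₃-trans
  }

infixl 7 _∙₃_
_∙₃_ : S₃ → S₃ → S₃
bot  ∙₃ _    = bot
unit ∙₃ b    = b
top  ∙₃ bot  = bot
top  ∙₃ unit = top
top  ∙₃ top  = top

infixr 6 _⊸₃_
_⊸₃_ : S₃ → S₃ → S₃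
bot  ⊸₃ _    = top
unit ⊸₃ c    = c
top  ⊸₃ bot  = bot
top  ⊸₃ unit = bot
top  ⊸₃ top  = top

∙₃-assoc : ∀ a b c → a ∙₃ b ∙₃ c ≡ a ∙₃ (b ∙₃ c)
∙₃-assoc bot  _    _    = refl
∙₃-assoc unit _    _    = refl
∙₃-assoc top  bot  _    = refl
∙₃-assoc top  unit _    = refl
∙₃-assoc top  top  bot  = refl
∙₃-assoc top  top  unit = refl
∙₃-assoc top  top  top  = refl

∙₃-identityʳ : ∀ a → a ∙₃ unit ≡ a
∙₃-identityʳ bot  = refl
∙₃-identityʳ unit = refl
∙₃-identityʳ top  = refl

∙₃-comm : ∀ a b → a ∙₃ b ≡ b ∙₃ a
∙₃-comm unit b    = sym (∙₃-identityʳ b)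
∙₃-comm a    unit = ∙₃-identityʳ a
∙₃-comm bot  bot  = refl
∙₃-comm bot  top  = refl
∙₃-comm top  bot  = refl
∙₃-comm top  top  = refl

∙₃-monoˡ-≤ : ∀ {a b} c → a ≤₃ b → a ∙₃ c ≤₃ b ∙₃ c
∙₃-monoˡ-≤ _    bot≤          = bot≤
∙₃-monoˡ-≤ _    unit≤unit     = ≤₃-refl
∙₃-monoˡ-≤ _    (≤top {top})  = ≤₃-refl
∙₃-monoˡ-≤ _    (≤top {bot})  = bot≤
∙₃-monoˡ-≤ bot  (≤top {unit}) = bot≤
∙₃-monoˡ-≤ unit (≤top {unit}) = ≤top
∙₃-monoˡ-≤ top  (≤top {unit}) = ≤top

⊸₃-intro : ∀ {a b c} → a ∙₃ b ≤₃ c → b ≤₃ a ⊸₃ c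
⊸₃-intro {bot}                _  = ≤top
⊸₃-intro {unit}               le = le
⊸₃-intro {top} {c = top}      _  = ≤top
⊸₃-intro {top} {bot}          _  = bot≤
⊸₃-intro {top} {unit} {bot}   ()
⊸₃-intro {top} {unit} {unit}  ()
⊸₃-intro {top} {top}  {bot}   ()
⊸₃-intro {top} {top}  {unit}  ()

⊸₃-elim : ∀ {a b c} → b ≤₃ a ⊸₃ c → a ∙₃ b ≤₃ c
⊸₃-elim {bot}                _    = bot≤
⊸₃-elim {unit}               le   = le
⊸₃-elim {top} {c = top}      _    = ≤top
⊸₃-elim {top} {c = bot}      bot≤ = bot≤
⊸₃-elim {top} {c = unit}     bot≤ = bot≤

sugihara₃ : ResiduatedCommutativePromonoid
sugihara₃ = record
  { Carrier     = S₃
  ; _≤_         = _≤₃_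
  ; _∙_         = _∙₃_
  ; ε           = unit
  ; _⊸_         = _⊸₃_
  ; isPreorder  = ≤₃-isPreorder
  ; ∙-assoc     = ∙₃-assoc
  ; ∙-comm      = ∙₃-comm
  ; ∙-identityˡ = λ _ → refl
  ; ∙-monoˡ-≤   = ∙₃-monoˡ-≤
  ; ⊸-intro     = ⊸₃-intro
  ; ⊸-elim      = ⊸₃-elim
  }

proposition5p6 : (A : AForm) → IFree A → ¬ (A ⊢ I)
proposition5p6 A = IFree⇒¬⊢I sugihara₃ {top} refl refl (λ ())
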